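{- Let $\vec f=\langle f_i:i<\omega\rangle$ be a sequence of increasing functions in $\omega^\omega$ and let $g\in\omega^\omega$ be monotone. Then $\vec f^g$ is increasing.
   Context: A function $f\in\omega^\omega$ is increasing if $n<m$ implies $f(n)<f(m)$, and monotone if $n<m$ implies $f(n)\le f(m)$. For $\vec f=\langle f_i:i<\omega\rangle\subseteq\omega^\omega$ and $g\in\omega^\omega$, the function $\vec f^g$ is defined by $\vec f^g(n)=f_0\circ f_1\circ\dots\circ f_{g(n)-1}(n)$ (with the empty composition being the identity, so $\vec f^g(n)=n$ when $g(n)=0$). -}

module Defs where

open import Data.Nat using (ℕ; zero; suc; _<_; _≤_)

Increasing : (ℕ → ℕ) → Set
Increasing f = ∀ {n m} → n < m → f n < f m

Monotone : (ℕ → ℕ) → Set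
Monotone f = ∀ {n m} → n < m → f n ≤ f m

-- compose fs k = f_0 ∘ f_1 ∘ … ∘ f_{k-1}  (identity when k = 0)
compose : (ℕ → ℕ → ℕ) → ℕ → ℕ → ℕ
compose fs zero    x = x
compose fs (suc k) x = compose fs k (fs k x)

-- (f⃗ ^ g)(n) = f_0 ∘ … ∘ f_{g(n)-1} (n)
iterSeq : (ℕ → ℕ → ℕ) → (ℕ → ℕ) → ℕ → ℕ
iterSeq fs g n = compose fs (g n) n

-- An increasing f on ℕ satisfies x ≤ f x, so prefixing one more increasing
-- function never lowers the value of a composition: compose fs k x is
-- monotone in k.  For n < m, first compose fs (g n) n < compose fs (g n) m
-- since a composition of increasing maps is increasing, and then
-- compose fs (g n) m ≤ compose fs (g m) m because g n ≤ g m.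
module Submission where

open import Defs
open import Data.Nat using (ℕ; zero; suc; _<_; _≤_; z≤n; s≤s)
open import Data.Nat.Properties
  using (≤-refl; ≤-trans; <-≤-trans; <⇒≤; n<1+n; m≤n⇒m<n∨m≡n)
open import Data.Sum using (inj₁; inj₂)
open import Relation.Binary.PropositionalEquality using (refl)

increasing⇒inflationary : ∀ {f : ℕ → ℕ} → Increasing f → ∀ x → x ≤ f x
increasing⇒inflationary inc zero    = z≤n
increasing⇒inflationary inc (suc x) =
  ≤-trans (s≤s (increasing⇒inflationary inc x)) (inc (n<1+n x))

increasing⇒≤-monotone : ∀ {f : ℕ → ℕ} → Increasing f → ∀ {x y} → x ≤ y → f x ≤ f y
increasing⇒≤-monotone inc x≤y with m≤n⇒m<n∨m≡n x≤y
... | inj₁ x<y  = <⇒≤ (inc x<y)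
... | inj₂ refl = ≤-refl

module _ {fs : ℕ → ℕ → ℕ} (fs-increasing : ∀ i → Increasing (fs i)) where

  compose-increasing : ∀ k → Increasing (compose fs k)
  compose-increasing zero    x<y = x<y
  compose-increasing (suc k) x<y = compose-increasing k (fs-increasing k x<y)

  compose-≤-suc : ∀ k x → compose fs k x ≤ compose fs (suc k) x
  compose-≤-suc k x = increasing⇒≤-monotone (compose-increasing k)
    (increasing⇒inflationary (fs-increasing k) x)

  compose-monotone : ∀ {k l} → k ≤ l → ∀ x → compose fs k x ≤ compose fs l x
  compose-monotone {l = l} k≤l x with m≤n⇒m<n∨m≡n k≤l
  ... | inj₂ refl = ≤-refl
  compose-monotone {l = suc l} _ x | inj₁ (s≤s k≤l) =
    ≤-trans (compose-monotone k≤l x) (compose-≤-suc l x)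

mainTheorem3 : (fs : ℕ → ℕ → ℕ) (g : ℕ → ℕ) →
    (∀ i → Increasing (fs i)) → Monotone g → Increasing (iterSeq fs g)
mainTheorem3 fs g fs-increasing g-monotone {n} {m} n<m =
  <-≤-trans (compose-increasing fs-increasing (g n) n<m)
            (compose-monotone fs-increasing (g-monotone n<m) m)
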